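{- Let $\alpha\in Fm''$. If there is a completed open tableau of $\mathbb T$ for $F(\alpha)$, then $\not\models_{\cal TML}\alpha$.
   Context: $M_4=\{\mathbf 0,\mathbf n,\mathbf b,\mathbf 1\}$ with $\neg\mathbf 0=\mathbf 1$, $\neg\mathbf 1=\mathbf 0$, $\neg\mathbf n=\mathbf n$, $\neg\mathbf b=\mathbf b$ and $\succ$: $\mathbf 0\succ y=\mathbf 1$; $\mathbf n\succ\mathbf 0=\mathbf n$, $\mathbf n\succ\mathbf n=\mathbf 1$, $\mathbf n\succ\mathbf b=\mathbf b$, $\mathbf n\succ\mathbf 1=\mathbf 1$; $\mathbf b\succ\mathbf 0=\mathbf b$, $\mathbf b\succ\mathbf n=\mathbf n$, $\mathbf b\succ\mathbf b=\mathbf 1$, $\mathbf b\succ\mathbf 1=\mathbf 1$; $\mathbf 1\succ y=y$. Formulas of $Fm''$ are built from propositional variables with $\neg$, $\succ$; a valuation is a homomorphism $h:Fm''\to M_4$; $\models_{\cal TML}\alpha$ means $h(\alpha)=\mathbf 1$ for every valuation $h$. Signed formulas are $T(\alpha)$, $F(\alpha)$. Rules of $\mathbb T$ (premise $\Rightarrow$ conclusion sets separated by $|$): $T(\alpha\succ\beta)\Rightarrow \{T(\beta)\}\,|\,\{T(\neg\alpha),F(\beta),T(\neg\beta)\}\,|\,\{F(\alpha),F(\beta),F(\neg\beta)\}$; $F(\alpha\succ\beta)\Rightarrow\{T(\alpha),F(\beta),F(\neg\beta)\}\,|\,\{F(\neg\alpha),F(\beta),T(\neg\beta)\}$; $T(\neg(\alpha\succ\beta))\Rightarrow\{T(\alpha),F(\beta),T(\neg\beta)\}\,|\,\{F(\neg\alpha),T(\beta),T(\neg\beta)\}$;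 $F(\neg(\alpha\succ\beta))\Rightarrow\{F(\neg\beta)\}\,|\,\{T(\neg\alpha),T(\beta),T(\neg\beta)\}\,|\,\{F(\alpha),F(\beta),T(\neg\beta)\}$; $T(\neg\neg\alpha)\Rightarrow\{T(\alpha)\}$; $F(\neg\neg\alpha)\Rightarrow\{F(\alpha)\}$. A tableau for $\eta$ is a finite tree with root $\eta$ built by repeatedly choosing a non-closed branch and a signed formula on it that is a rule premise, and extending the branch by one sub-branch per conclusion set. A branch is closed if it contains $T(\gamma)$ and $F(\gamma)$ for some $\gamma$, open otherwise; a tableau is open if some branch is open; it is completed if on every non-closed branch every rule whose premise occurs on the branch has been applied to it along that branch. -}

module Defs where

open import Data.Nat using (ℕ)
open import Data.List using (List; []; _∷_; _++_; map)
open import Data.List.Membership.Propositional using (_∈_)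
open import Data.List.Relation.Unary.All using (All; []; _∷_)
open import Data.Product using (Σ; _×_; _,_; ∃)
open import Relation.Nullary using (¬_)
open import Relation.Binary.PropositionalEquality using (_≡_)

data M4 : Set where
  𝟎 𝐧 𝐛 𝟏 : M4

neg : M4 → M4
neg 𝟎 = 𝟏
neg 𝟏 = 𝟎
neg 𝐧 = 𝐧
neg 𝐛 = 𝐛

imp : M4 → M4 → M4
imp 𝟎 y = 𝟏
imp 𝐧 𝟎 = 𝐧
imp 𝐧 𝐧 = 𝟏
imp 𝐧 𝐛 = 𝐛
imp 𝐧 𝟏 = 𝟏
imp 𝐛 𝟎 = 𝐛
imp 𝐛 𝐧 = 𝐧
imp 𝐛 𝐛 = 𝟏
imp 𝐛 𝟏 = 𝟏
imp 𝟏 y = y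

data Fm : Set where
  var : ℕ → Fm
  ¬' : Fm → Fm
  _≻_ : Fm → Fm → Fm

infixr 5 _≻_

-- A valuation h : Fm'' → M4 homomorphism is determined by its values on variables;
-- ⟦ α ⟧ v is the homomorphic extension of v : ℕ → M4.
⟦_⟧ : Fm → (ℕ → M4) → M4
⟦ var x ⟧ v = v x
⟦ ¬' a ⟧ v = neg (⟦ a ⟧ v)
⟦ a ≻ b ⟧ v = imp (⟦ a ⟧ v) (⟦ b ⟧ v)

Valid : Fm → Set
Valid α = ∀ (v : ℕ → M4) → ⟦ α ⟧ v ≡ 𝟏

data SF : Set where
  T F : Fm → SF

-- Rules of 𝕋 : premise ⇒ list of conclusion sets
data Rule : SF → List (List SF) → Set where
  T≻  : ∀ a b → Rule (T (a ≻ b))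
          ((T b ∷ []) ∷ (T (¬' a) ∷ F b ∷ T (¬' b) ∷ []) ∷ (F a ∷ F b ∷ F (¬' b) ∷ []) ∷ [])
  F≻  : ∀ a b → Rule (F (a ≻ b))
          ((T a ∷ F b ∷ F (¬' b) ∷ []) ∷ (F (¬' a) ∷ F b ∷ T (¬' b) ∷ []) ∷ [])
  T¬≻ : ∀ a b → Rule (T (¬' (a ≻ b)))
          ((T a ∷ F b ∷ T (¬' b) ∷ []) ∷ (F (¬' a) ∷ T b ∷ T (¬' b) ∷ []) ∷ [])
  F¬≻ : ∀ a b → Rule (F (¬' (a ≻ b)))
          ((F (¬' b) ∷ []) ∷ (T (¬' a) ∷ T b ∷ T (¬' b) ∷ []) ∷ (F a ∷ F b ∷ T (¬' b) ∷ []) ∷ [])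
  T¬¬ : ∀ a → Rule (T (¬' (¬' a))) ((T a ∷ []) ∷ [])
  F¬¬ : ∀ a → Rule (F (¬' (¬' a))) ((F a ∷ []) ∷ [])

IsPremise : SF → Set
IsPremise φ = ∃ λ cs → Rule φ cs

Closed : List SF → Set
Closed b = ∃ λ γ → (T γ ∈ b) × (F γ ∈ b)

-- Tableaux, indexed by the current branch contents `br` (all formulas on the
-- path from the root to the current node).
data Tab (br : List SF) : Set where
  leaf : Tab br
  node : (φ : SF) → φ ∈ br → ¬ Closed br →
         (cs : List (List SF)) → Rule φ cs →
         All (λ C → Tab (C ++ br)) cs → Tab br

-- Branches of a tableau: for each leaf, the formulas on the branch and the
-- list of premises to which a rule was applied along that branch.
mutual
  branches : ∀ {br} → Tab br → List (List SF × List SF)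
  branches {br} leaf = (br , []) ∷ []
  branches (node φ _ _ cs _ ts) = map (λ { (b , a) → (b , φ ∷ a) }) (branchesAll ts)

  branchesAll : ∀ {br} {cs : List (List SF)} → All (λ C → Tab (C ++ br)) cs → List (List SF × List SF)
  branchesAll [] = []
  branchesAll (t ∷ ts) = branches t ++ branchesAll ts

OpenTab : ∀ {br} → Tab br → Set
OpenTab t = ∃ λ ba → (ba ∈ branches t) × ¬ Closed (Data.Product.proj₁ ba)

Completed : ∀ {br} → Tab br → Set
Completed t = ∀ b a → (b , a) ∈ branches t → ¬ Closed b →
              ∀ φ → φ ∈ b → IsPremise φ → φ ∈ a

TableauFor : SF → Set
TableauFor η = Tab (η ∷ [])

-- Read an element of M4 as a pair of bits (is it true?, is it false?): 𝟏 is only true,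
-- 𝟎 only false, 𝐛 both and 𝐧 neither; T α says that α is true and T ¬α that α is false.
-- An open completed branch b is then a Hintikka set: the valuation giving each variable p
-- the truth bit [T p ∈ b] and the falsity bit [T ¬p ∈ b] makes every signed formula of b
-- hold, by induction on a weight that every rule lowers, because every rule is invertible
-- in M4 (whenever one conclusion set holds, so does the premise).  The root F α in
-- particular holds, so α takes an undesignated value.
module Submission where

open import Defs
open import Data.Bool using (Bool; true; false)
open import Data.Nat using (ℕ; suc; _+_; _<_; s≤s)
open import Data.Nat.Induction using (<-wellFounded)
open import Data.Nat.Properties using (n<1+n; m<n⇒m<1+n; <-trans; m≤m+n; m≤n+m)
import Data.Nat.Properties as ℕ
open import Data.List using (List; []; _∷_; _++_)
open import Data.List.Relation.Unary.All as All using (All; []; _∷_)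
open import Data.List.Relation.Unary.Any using (here; there)
open import Data.List.Membership.Propositional using (_∈_)
open import Data.List.Membership.Propositional.Properties using (∈-map⁻; ∈-++⁻)
open import Data.List.Relation.Binary.Subset.Propositional using (_⊆_)
open import Data.List.Relation.Binary.Subset.Propositional.Properties using (xs⊆xs++ys; xs⊆ys++xs)
open import Data.Product using (Σ; _×_; _,_; ∃; ∃₂; proj₁; proj₂)
open import Data.Sum using (_⊎_; inj₁; inj₂)
open import Function using (_∘_; id; _on_)
open import Induction.WellFounded using (WellFounded; Acc; acc)
open import Relation.Binary.Construct.On using (wellFounded)
open import Relation.Binary.Definitions using (DecidableEquality)
open import Relation.Binary.PropositionalEquality using (_≡_; refl; sym; trans; cong; cong₂)
open import Relation.Nullary using (¬_; no; does; contradiction)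
open import Relation.Nullary.Decidable using (map′; _×-dec_; dec-true; dec-false)

designated : M4 → Bool
designated 𝟎 = false
designated 𝐧 = false
designated 𝐛 = true
designated 𝟏 = true

ofBits : Bool → Bool → M4
ofBits true  true  = 𝐛
ofBits true  false = 𝟏
ofBits false true  = 𝟎
ofBits false false = 𝐧

designated-ofBits : ∀ t f → designated (ofBits t f) ≡ t
designated-ofBits true  true  = refl
designated-ofBits true  false = refl
designated-ofBits false true  = refl
designated-ofBits false false = refl

designated-neg-ofBits : ∀ t f → designated (neg (ofBits t f)) ≡ f
designated-neg-ofBits true  true  = refl
designated-neg-ofBits true  false = refl
designated-neg-ofBits false true  = refl
designated-neg-ofBits false false = refl

neg-involutive : ∀ x → neg (neg x) ≡ x
neg-involutive 𝟎 = refl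
neg-involutive 𝐧 = refl
neg-involutive 𝐛 = refl
neg-involutive 𝟏 = refl

imp-designated₁ : ∀ x y → designated y ≡ true → designated (imp x y) ≡ true
imp-designated₁ _ 𝟎 ()
imp-designated₁ _ 𝐧 ()
imp-designated₁ 𝟎 𝐛 _ = refl
imp-designated₁ 𝐧 𝐛 _ = refl
imp-designated₁ 𝐛 𝐛 _ = refl
imp-designated₁ 𝟏 𝐛 _ = refl
imp-designated₁ 𝟎 𝟏 _ = refl
imp-designated₁ 𝐧 𝟏 _ = refl
imp-designated₁ 𝐛 𝟏 _ = refl
imp-designated₁ 𝟏 𝟏 _ = refl

imp-designated₂ : ∀ x y → designated (neg x) ≡ true → designated y ≡ false →
                  designated (neg y) ≡ true → designated (imp x y) ≡ true
imp-designated₂ _ 𝐧 _ _ ()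
imp-designated₂ _ 𝐛 _ () _
imp-designated₂ _ 𝟏 _ () _
imp-designated₂ 𝟎 𝟎 _ _ _ = refl
imp-designated₂ 𝐧 𝟎 () _ _
imp-designated₂ 𝐛 𝟎 _ _ _ = refl
imp-designated₂ 𝟏 𝟎 () _ _

imp-designated₃ : ∀ x y → designated x ≡ false → designated y ≡ false →
                  designated (neg y) ≡ false → designated (imp x y) ≡ true
imp-designated₃ _ 𝟎 _ _ ()
imp-designated₃ _ 𝐛 _ () _
imp-designated₃ _ 𝟏 _ () _
imp-designated₃ 𝟎 𝐧 _ _ _ = refl
imp-designated₃ 𝐧 𝐧 _ _ _ = refl
imp-designated₃ 𝐛 𝐧 () _ _
imp-designated₃ 𝟏 𝐧 () _ _

imp-undesignated₁ : ∀ x y → designated x ≡ true → designated y ≡ false →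
                    designated (neg y) ≡ false → designated (imp x y) ≡ false
imp-undesignated₁ _ 𝟎 _ _ ()
imp-undesignated₁ _ 𝐛 _ () _
imp-undesignated₁ _ 𝟏 _ () _
imp-undesignated₁ 𝟎 𝐧 () _ _
imp-undesignated₁ 𝐧 𝐧 () _ _
imp-undesignated₁ 𝐛 𝐧 _ _ _ = refl
imp-undesignated₁ 𝟏 𝐧 _ _ _ = refl

imp-undesignated₂ : ∀ x y → designated (neg x) ≡ false → designated y ≡ false →
                    designated (neg y) ≡ true → designated (imp x y) ≡ false
imp-undesignated₂ _ 𝐧 _ _ ()
imp-undesignated₂ _ 𝐛 _ () _
imp-undesignated₂ _ 𝟏 _ () _
imp-undesignated₂ 𝟎 𝟎 () _ _
imp-undesignated₂ 𝐧 𝟎 _ _ _ = refl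
imp-undesignated₂ 𝐛 𝟎 () _ _
imp-undesignated₂ 𝟏 𝟎 _ _ _ = refl

neg-imp-designated₁ : ∀ x y → designated x ≡ true → designated y ≡ false →
                      designated (neg y) ≡ true → designated (neg (imp x y)) ≡ true
neg-imp-designated₁ _ 𝐧 _ _ ()
neg-imp-designated₁ _ 𝐛 _ () _
neg-imp-designated₁ _ 𝟏 _ () _
neg-imp-designated₁ 𝟎 𝟎 () _ _
neg-imp-designated₁ 𝐧 𝟎 () _ _
neg-imp-designated₁ 𝐛 𝟎 _ _ _ = refl
neg-imp-designated₁ 𝟏 𝟎 _ _ _ = refl

neg-imp-designated₂ : ∀ x y → designated (neg x) ≡ false → designated y ≡ true →
                      designated (neg y) ≡ true → designated (neg (imp x y)) ≡ true
neg-imp-designated₂ _ 𝟎 _ () _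
neg-imp-designated₂ _ 𝐧 _ () _
neg-imp-designated₂ _ 𝟏 _ _ ()
neg-imp-designated₂ 𝟎 𝐛 () _ _
neg-imp-designated₂ 𝐧 𝐛 _ _ _ = refl
neg-imp-designated₂ 𝐛 𝐛 () _ _
neg-imp-designated₂ 𝟏 𝐛 _ _ _ = refl

neg-imp-undesignated₁ : ∀ x y → designated (neg y) ≡ false → designated (neg (imp x y)) ≡ false
neg-imp-undesignated₁ _ 𝟎 ()
neg-imp-undesignated₁ _ 𝐛 ()
neg-imp-undesignated₁ 𝟎 𝐧 _ = refl
neg-imp-undesignated₁ 𝐧 𝐧 _ = refl
neg-imp-undesignated₁ 𝐛 𝐧 _ = refl
neg-imp-undesignated₁ 𝟏 𝐧 _ = refl
neg-imp-undesignated₁ 𝟎 𝟏 _ = refl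
neg-imp-undesignated₁ 𝐧 𝟏 _ = refl
neg-imp-undesignated₁ 𝐛 𝟏 _ = refl
neg-imp-undesignated₁ 𝟏 𝟏 _ = refl

neg-imp-undesignated₂ : ∀ x y → designated (neg x) ≡ true → designated y ≡ true →
                        designated (neg y) ≡ true → designated (neg (imp x y)) ≡ false
neg-imp-undesignated₂ _ 𝟎 _ () _
neg-imp-undesignated₂ _ 𝐧 _ () _
neg-imp-undesignated₂ _ 𝟏 _ _ ()
neg-imp-undesignated₂ 𝟎 𝐛 _ _ _ = refl
neg-imp-undesignated₂ 𝐧 𝐛 () _ _
neg-imp-undesignated₂ 𝐛 𝐛 _ _ _ = refl
neg-imp-undesignated₂ 𝟏 𝐛 () _ _

neg-imp-undesignated₃ : ∀ x y → designated x ≡ false → designated y ≡ false →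
                        designated (neg y) ≡ true → designated (neg (imp x y)) ≡ false
neg-imp-undesignated₃ _ 𝐧 _ _ ()
neg-imp-undesignated₃ _ 𝐛 _ () _
neg-imp-undesignated₃ _ 𝟏 _ () _
neg-imp-undesignated₃ 𝟎 𝟎 _ _ _ = refl
neg-imp-undesignated₃ 𝐧 𝟎 _ _ _ = refl
neg-imp-undesignated₃ 𝐛 𝟎 () _ _
neg-imp-undesignated₃ 𝟏 𝟎 () _ _

Sat : (ℕ → M4) → SF → Set
Sat v (T a) = designated (⟦ a ⟧ v) ≡ true
Sat v (F a) = designated (⟦ a ⟧ v) ≡ false

premise-sat : ∀ v {φ cs C} → Rule φ cs → C ∈ cs → All (Sat v) C → Sat v φ
premise-sat v (T≻ a b) (here refl) (b⁺ ∷ []) =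
  imp-designated₁ (⟦ a ⟧ v) _ b⁺
premise-sat v (T≻ a b) (there (here refl)) (a⁻ ∷ b⁺ ∷ b⁻ ∷ []) =
  imp-designated₂ (⟦ a ⟧ v) _ a⁻ b⁺ b⁻
premise-sat v (T≻ a b) (there (there (here refl))) (a⁺ ∷ b⁺ ∷ b⁻ ∷ []) =
  imp-designated₃ (⟦ a ⟧ v) _ a⁺ b⁺ b⁻
premise-sat v (F≻ a b) (here refl) (a⁺ ∷ b⁺ ∷ b⁻ ∷ []) =
  imp-undesignated₁ (⟦ a ⟧ v) _ a⁺ b⁺ b⁻
premise-sat v (F≻ a b) (there (here refl)) (a⁻ ∷ b⁺ ∷ b⁻ ∷ []) =
  imp-undesignated₂ (⟦ a ⟧ v) _ a⁻ b⁺ b⁻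
premise-sat v (T¬≻ a b) (here refl) (a⁺ ∷ b⁺ ∷ b⁻ ∷ []) =
  neg-imp-designated₁ (⟦ a ⟧ v) _ a⁺ b⁺ b⁻
premise-sat v (T¬≻ a b) (there (here refl)) (a⁻ ∷ b⁺ ∷ b⁻ ∷ []) =
  neg-imp-designated₂ (⟦ a ⟧ v) _ a⁻ b⁺ b⁻
premise-sat v (F¬≻ a b) (here refl) (b⁻ ∷ []) =
  neg-imp-undesignated₁ (⟦ a ⟧ v) _ b⁻
premise-sat v (F¬≻ a b) (there (here refl)) (a⁻ ∷ b⁺ ∷ b⁻ ∷ []) =
  neg-imp-undesignated₂ (⟦ a ⟧ v) _ a⁻ b⁺ b⁻
premise-sat v (F¬≻ a b) (there (there (here refl))) (a⁺ ∷ b⁺ ∷ b⁻ ∷ []) =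
  neg-imp-undesignated₃ (⟦ a ⟧ v) _ a⁺ b⁺ b⁻
premise-sat v (T¬¬ a) (here refl) (a⁺ ∷ []) = trans (cong designated (neg-involutive _)) a⁺
premise-sat v (F¬¬ a) (here refl) (a⁺ ∷ []) = trans (cong designated (neg-involutive _)) a⁺

-- An implication weighs 2 more than its parts so that ¬a and ¬b are lighter than a ≻ b.
weight : Fm → ℕ
weight (var _) = 0
weight (¬' a) = suc (weight a)
weight (a ≻ b) = suc (suc (weight a + weight b))

formula : SF → Fm
formula (T a) = a
formula (F a) = a

_≺_ : SF → SF → Set
_≺_ = _<_ on (weight ∘ formula)

≺-wellFounded : WellFounded _≺_
≺-wellFounded = wellFounded (weight ∘ formula) <-wellFounded

≻-components-lighter : ∀ a b → let w = weight (a ≻ b) in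
  weight a < w × weight (¬' a) < w × weight b < w × weight (¬' b) < w
≻-components-lighter a b =
  <-trans (n<1+n _) ¬a< , ¬a< , <-trans (n<1+n _) ¬b< , ¬b<
  where
    ¬a< : weight (¬' a) < weight (a ≻ b)
    ¬a< = s≤s (s≤s (m≤m+n (weight a) (weight b)))
    ¬b< : weight (¬' b) < weight (a ≻ b)
    ¬b< = s≤s (s≤s (m≤n+m (weight b) (weight a)))

conclusions-lighter : ∀ {φ cs} → Rule φ cs → All (All (_≺ φ)) cs
conclusions-lighter (T≻ a b) with ≻-components-lighter a b
... | a< , ¬a< , b< , ¬b< =
  (b< ∷ []) ∷ (¬a< ∷ b< ∷ ¬b< ∷ []) ∷ (a< ∷ b< ∷ ¬b< ∷ []) ∷ []
conclusions-lighter (F≻ a b) with ≻-components-lighter a b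
... | a< , ¬a< , b< , ¬b< =
  (a< ∷ b< ∷ ¬b< ∷ []) ∷ (¬a< ∷ b< ∷ ¬b< ∷ []) ∷ []
conclusions-lighter (T¬≻ a b) with ≻-components-lighter a b
... | a< , ¬a< , b< , ¬b< =
  All.map (All.map m<n⇒m<1+n) ((a< ∷ b< ∷ ¬b< ∷ []) ∷ (¬a< ∷ b< ∷ ¬b< ∷ []) ∷ [])
conclusions-lighter (F¬≻ a b) with ≻-components-lighter a b
... | a< , ¬a< , b< , ¬b< =
  All.map (All.map m<n⇒m<1+n) ((¬b< ∷ []) ∷ (¬a< ∷ b< ∷ ¬b< ∷ []) ∷ (a< ∷ b< ∷ ¬b< ∷ []) ∷ [])
conclusions-lighter (T¬¬ a) = ((<-trans (n<1+n _) (n<1+n _)) ∷ []) ∷ []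
conclusions-lighter (F¬¬ a) = ((<-trans (n<1+n _) (n<1+n _)) ∷ []) ∷ []

data Literal : SF → Set where
  T-var  : ∀ p → Literal (T (var p))
  F-var  : ∀ p → Literal (F (var p))
  T-¬var : ∀ p → Literal (T (¬' (var p)))
  F-¬var : ∀ p → Literal (F (¬' (var p)))

premise-or-literal : ∀ φ → IsPremise φ ⊎ Literal φ
premise-or-literal (T (var p))         = inj₂ (T-var p)
premise-or-literal (T (¬' (var p)))    = inj₂ (T-¬var p)
premise-or-literal (T (¬' (¬' a)))     = inj₁ (_ , T¬¬ a)
premise-or-literal (T (¬' (a ≻ b)))    = inj₁ (_ , T¬≻ a b)
premise-or-literal (T (a ≻ b))         = inj₁ (_ , T≻ a b)
premise-or-literal (F (var p))         = inj₂ (F-var p)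
premise-or-literal (F (¬' (var p)))    = inj₂ (F-¬var p)
premise-or-literal (F (¬' (¬' a)))     = inj₁ (_ , F¬¬ a)
premise-or-literal (F (¬' (a ≻ b)))    = inj₁ (_ , F¬≻ a b)
premise-or-literal (F (a ≻ b))         = inj₁ (_ , F≻ a b)

_≟ᶠ_ : DecidableEquality Fm
var m  ≟ᶠ var n  = map′ (cong var) (λ { refl → refl }) (m ℕ.≟ n)
¬' a   ≟ᶠ ¬' b   = map′ (cong ¬') (λ { refl → refl }) (a ≟ᶠ b)
(a ≻ b) ≟ᶠ (c ≻ d) =
  map′ (λ (p , q) → cong₂ _≻_ p q) (λ { refl → refl , refl }) ((a ≟ᶠ c) ×-dec (b ≟ᶠ d))
var _  ≟ᶠ ¬' _   = no λ ()
var _  ≟ᶠ (_ ≻ _) = no λ ()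
¬' _   ≟ᶠ var _  = no λ ()
¬' _   ≟ᶠ (_ ≻ _) = no λ ()
(_ ≻ _) ≟ᶠ var _  = no λ ()
(_ ≻ _) ≟ᶠ ¬' _   = no λ ()

_≟ˢ_ : DecidableEquality SF
T a ≟ˢ T b = map′ (cong T) (λ { refl → refl }) (a ≟ᶠ b)
F a ≟ˢ F b = map′ (cong F) (λ { refl → refl }) (a ≟ᶠ b)
T _ ≟ˢ F _ = no λ ()
F _ ≟ˢ T _ = no λ ()

Expanded : List SF → SF → Set
Expanded b φ = ∃₂ λ cs C → Rule φ cs × C ∈ cs × C ⊆ b

Saturated : List SF → Set
Saturated b = ∀ {φ} → φ ∈ b → IsPremise φ → Expanded b φ

mutual
  branch-invariant : ∀ {br} (t : Tab br) {b a} → (b , a) ∈ branches t →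
                     br ⊆ b × (∀ {φ} → φ ∈ a → Expanded b φ)
  branch-invariant leaf (here refl) = id , λ ()
  branch-invariant (node φ _ _ cs r ts) b,a∈t with ∈-map⁻ _ b,a∈t
  ... | _ , b,a∈ts , refl with branchesAll-invariant ts b,a∈ts
  ... | C , C∈cs , C++br⊆b , expanded =
    C++br⊆b ∘ xs⊆ys++xs _ C ,
    λ { (here refl) → cs , C , r , C∈cs , C++br⊆b ∘ xs⊆xs++ys C _
      ; (there ψ∈a) → expanded ψ∈a }

  branchesAll-invariant : ∀ {br cs} (ts : All (λ C → Tab (C ++ br)) cs) {b a} →
                          (b , a) ∈ branchesAll ts →
                          ∃ λ C → C ∈ cs × C ++ br ⊆ b × (∀ {φ} → φ ∈ a → Expanded b φ)
  branchesAll-invariant (t ∷ ts) b,a∈ts with ∈-++⁻ (branches t) b,a∈ts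
  ... | inj₁ b,a∈t = _ , here refl , branch-invariant t b,a∈t
  ... | inj₂ b,a∈ts′ with branchesAll-invariant ts b,a∈ts′
  ...   | C , C∈cs , rest = C , there C∈cs , rest

open-branch-saturated : ∀ {br} (t : Tab br) → Completed t → ∀ {b a} →
                        (b , a) ∈ branches t → ¬ Closed b → Saturated b
open-branch-saturated t completed b,a∈t ¬closed φ∈b premise =
  proj₂ (branch-invariant t b,a∈t) (completed _ _ b,a∈t ¬closed _ φ∈b premise)

module Hintikka {b : List SF} (¬closed : ¬ Closed b) (saturated : Saturated b) where

  open import Data.List.Membership.DecPropositional _≟ˢ_ using (_∈?_)

  valuation : ℕ → M4
  valuation p = ofBits (does (T (var p) ∈? b)) (does (T (¬' (var p)) ∈? b))

  literal-sat : ∀ {φ} → Literal φ → φ ∈ b → Sat valuation φ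
  literal-sat (T-var p) φ∈b =
    trans (designated-ofBits _ _) (dec-true (T (var p) ∈? b) φ∈b)
  literal-sat (F-var p) φ∈b =
    trans (designated-ofBits _ _) (dec-false (T (var p) ∈? b) λ T∈b → ¬closed (_ , T∈b , φ∈b))
  literal-sat (T-¬var p) φ∈b =
    trans (designated-neg-ofBits _ _) (dec-true (T (¬' (var p)) ∈? b) φ∈b)
  literal-sat (F-¬var p) φ∈b =
    trans (designated-neg-ofBits _ _) (dec-false (T (¬' (var p)) ∈? b) λ T∈b → ¬closed (_ , T∈b , φ∈b))

  sat-on-branch : ∀ {φ} → Acc _≺_ φ → φ ∈ b → Sat valuation φ
  sat-on-branch {φ} (acc lighter) φ∈b with premise-or-literal φ
  ... | inj₂ literal = literal-sat literal φ∈b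
  ... | inj₁ premise with saturated φ∈b premise
  ...   | _ , _ , r , C∈cs , C⊆b = premise-sat valuation r C∈cs (All.tabulate λ ψ∈C →
          sat-on-branch (lighter (All.lookup (All.lookup (conclusions-lighter r) C∈cs) ψ∈C)) (C⊆b ψ∈C))

undesignated-not-valid : ∀ α v → Sat v (F α) → ¬ Valid α
undesignated-not-valid _ v undesignated valid =
  contradiction (trans (sym undesignated) (cong designated (valid v))) λ ()

proposition5p7 : (α : Fm) →
    Σ (TableauFor (F α)) (λ t → Completed t × OpenTab t) →
    ¬ Valid α
proposition5p7 α (t , completed , (b , a) , b,a∈t , ¬closed) =
  undesignated-not-valid α valuation (sat-on-branch (≺-wellFounded _) root∈b)
  where
    open Hintikka ¬closed (open-branch-saturated t completed b,a∈t ¬closed)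
    root∈b : F α ∈ b
    root∈b = proj₁ (branch-invariant t b,a∈t) (here refl)
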